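{- Let $n\geq 15$ be an integer with $n\equiv 3 \pmod{12}$. Then there exists a $3$-star system of order $n$ which is $(n-1)$-block-colourable.
   Context: A $3$-star is a copy of the complete bipartite graph $K_{1,3}$. A $3$-star system of order $n$ is a pair $(V,\mathcal{B})$ where $|V|=n$ and $\mathcal{B}$ is a set of $3$-stars (subgraphs of the complete graph $K_n$ on $V$) whose edge sets partition the edge set of $K_n$; the elements of $\mathcal B$ are called blocks. A block-colouring is a partition of $\mathcal{B}$ into colour classes such that the blocks in each colour class are pairwise vertex-disjoint. The system is $k$-block-colourable if it admits a block-colouring with $k$ colour classes. -}

module Defs where

open import Data.Nat using (ℕ)
open import Data.Fin using (Fin)
open import Data.Product using (Σ; _×_)
open import Data.Sum using (_⊎_)
open import Relation.Binary.PropositionalEquality using (_≡_)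
open import Relation.Nullary using (¬_)

record Star (n : ℕ) : Set where
  field
    centre : Fin n
    leaf₁ leaf₂ leaf₃ : Fin n
    c≢1 : ¬ centre ≡ leaf₁
    c≢2 : ¬ centre ≡ leaf₂
    c≢3 : ¬ centre ≡ leaf₃
    1≢2 : ¬ leaf₁ ≡ leaf₂
    1≢3 : ¬ leaf₁ ≡ leaf₃
    2≢3 : ¬ leaf₂ ≡ leaf₃
open Star public

IsLeaf : {n : ℕ} → Fin n → Star n → Set
IsLeaf v s = (v ≡ leaf₁ s) ⊎ (v ≡ leaf₂ s) ⊎ (v ≡ leaf₃ s)

VertexOf : {n : ℕ} → Fin n → Star n → Set
VertexOf v s = (v ≡ centre s) ⊎ IsLeaf v s

EdgeOf : {n : ℕ} → Fin n → Fin n → Star n → Set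
EdgeOf x y s = (x ≡ centre s × IsLeaf y s) ⊎ (y ≡ centre s × IsLeaf x s)

IsStarSystem : (n m : ℕ) → (Fin m → Star n) → Set
IsStarSystem n m B =
  (x y : Fin n) → ¬ x ≡ y →
  Σ (Fin m) (λ i → EdgeOf x y (B i) × ((j : Fin m) → EdgeOf x y (B j) → j ≡ i))

VertexDisjoint : {n : ℕ} → Star n → Star n → Set
VertexDisjoint s t = (v : Fin _) → VertexOf v s → ¬ VertexOf v t

-- A block-colouring with exactly k colour classes: a map from blocks onto
-- Fin k (surjective, so the k classes are nonempty and partition the blocks)
-- such that distinct blocks of the same colour are vertex-disjoint.
IsBlockColouring : {n m : ℕ} → (Fin m → Star n) → (k : ℕ) → (Fin m → Fin k) → Set
IsBlockColouring {n} {m} B k col =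
  ((c : Fin k) → Σ (Fin m) (λ i → col i ≡ c)) ×
  ((i j : Fin m) → ¬ i ≡ j → col i ≡ col j → VertexDisjoint (B i) (B j))

BlockColourable : {n m : ℕ} → (Fin m → Star n) → ℕ → Set
BlockColourable {n} {m} B k = Σ (Fin m → Fin k) (IsBlockColouring B k)

-- Write n = 12t + 3 (t ≥ 1) and take as vertices three points ∞ and t groups G₀, …, G_{t−1} of
-- twelve points.  The edges of K_n split into a K₁₅ on ∞ ∪ G₀, a K_{3,12} joining ∞ to each other
-- group, a K₁₂ on each other group and a K_{12,12} between any two groups.  Each of these four
-- graphs has an explicit 3-star decomposition with a proper block-colouring, verified by
-- evaluation.  The colours are shared between the pieces through the symmetric Latin square
-- (g, h) ↦ g + h of ℤ_t: the K_{12,12} between G_g and G_h uses the eight colours (g + h, k); the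
-- K₁₂ on G_g, and for g = 0 the K₁₅, uses the eight colours (2g, k), four colours (0, r) and two
-- global colours; the K_{3,12} at G_g uses four colours (g, r) of its own.  Two blocks of the
-- same colour meeting in a vertex of G_g then belong to the same piece, since g and the symbol s
-- determine the other group s − g.  Altogether 8t + 4t + 2 = n − 1 colours are used.

module Submission where

open import Defs
open import Agda.Builtin.FromNat using (Number)
open import Data.Empty using (⊥)
open import Data.Fin using (Fin; zero; suc; toℕ; fromℕ<; splitAt; join; _↑ˡ_; _↑ʳ_)
open import Data.Fin.Properties
  using (_≟_; all?; any?; suc-injective; toℕ-injective; toℕ-fromℕ<; toℕ<n; splitAt-join; join-splitAt;
         +↔⊎; *↔×; 0↔⊥; 1↔⊤)
import Data.Fin.Literals as Fin
open import Data.List using (List; length)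
import Data.List as List
open import Data.Maybe using (Maybe; just; nothing)
open import Data.Maybe.Properties using (just-injective)
open import Data.Nat using (ℕ; zero; suc; _+_; _*_; _∸_; _%_; _/_; _≤_; _<_; _<?_; _≤?_)
import Data.Nat.Literals as ℕ
open import Data.Nat.DivMod
  using (_mod_; m%n<n; m%n%n≡m%n; %-distribˡ-+; [m+n]%n≡m%n; m<n⇒m%n≡m; m≡m%n+[m/n]*n)
open import Data.Nat.Properties using (+-assoc; +-comm; m+[n∸m]≡n; <⇒≤)
open import Data.Product using (Σ; ∃; ∃₂; _×_; _,_; proj₁; proj₂; uncurry; curry)
open import Data.Product.Function.Dependent.Propositional using (Σ-↔)
open import Data.Product.Function.NonDependent.Propositional using (_×-↔_)
open import Data.Product.Properties using (≡-dec)
open import Data.Sum using (_⊎_; inj₁; inj₂; [_,_]′)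
import Data.Sum as Sum
open import Data.Sum.Function.Propositional using (_⊎-↔_)
open import Data.Unit using (⊤; tt)
open import Data.Vec using (Vec)
import Data.Vec as Vec
open import Data.Vec.Functional using (_++_)
open import Data.Vec.Functional.Properties using (lookup-++ˡ)
open import Function using (_∘_)
open import Function.Bundles using (_↔_; Inverse; mk↔ₛ′)
open import Function.Definitions using (Injective)
open import Function.Properties.Inverse using (↔-refl; ↔-sym; ↔-trans)
open import Relation.Binary using (Symmetric; DecidableEquality)
open import Relation.Binary.PropositionalEquality
  using (_≡_; _≢_; refl; sym; trans; cong; cong₂; subst; subst₂; ≢-sym; module ≡-Reasoning)
open import Relation.Nullary using (Dec; yes; no; ¬?; contradiction)
open import Relation.Nullary.Decidable
  using (True; toWitness; map′; from-yes; from-no; _×-dec_; _⊎-dec_; _→-dec_)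

private
  variable
    A B : Set
    m n p q : ℕ
    x y : Fin n
    s : Star n

Distinct : Fin n → Fin n → Fin n → Fin n → Set
Distinct c x y z = c ≢ x × c ≢ y × c ≢ z × x ≢ y × x ≢ z × y ≢ z

distinct? : (c x y z : Fin n) → Dec (Distinct c x y z)
distinct? c x y z =
  ¬? (c ≟ x) ×-dec ¬? (c ≟ y) ×-dec ¬? (c ≟ z) ×-dec
  ¬? (x ≟ y) ×-dec ¬? (x ≟ z) ×-dec ¬? (y ≟ z)

⟨_∣_,_,_⟩ : (c x y z : Fin n) → {True (distinct? c x y z)} → Star n
⟨ c ∣ x , y , z ⟩ {distinct} with toWitness distinct
... | c≢x , c≢y , c≢z , x≢y , x≢z , y≢z = record
  { centre = c ; leaf₁ = x ; leaf₂ = y ; leaf₃ = z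
  ; c≢1 = c≢x ; c≢2 = c≢y ; c≢3 = c≢z ; 1≢2 = x≢y ; 1≢3 = x≢z ; 2≢3 = y≢z }

isLeaf? : (v : Fin n) (s : Star n) → Dec (IsLeaf v s)
isLeaf? v s = (v ≟ leaf₁ s) ⊎-dec (v ≟ leaf₂ s) ⊎-dec (v ≟ leaf₃ s)

vertexOf? : (v : Fin n) (s : Star n) → Dec (VertexOf v s)
vertexOf? v s = (v ≟ centre s) ⊎-dec isLeaf? v s

edgeOf? : (x y : Fin n) (s : Star n) → Dec (EdgeOf x y s)
edgeOf? x y s = ((x ≟ centre s) ×-dec isLeaf? y s) ⊎-dec ((y ≟ centre s) ×-dec isLeaf? x s)

vertexDisjoint? : (s t : Star n) → Dec (VertexDisjoint s t)
vertexDisjoint? s t = all? λ v → vertexOf? v s →-dec ¬? (vertexOf? v t)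

OnEdges : (Fin n → Fin n → Set) → Star n → Set
OnEdges P s = P (centre s) (leaf₁ s) × P (centre s) (leaf₂ s) × P (centre s) (leaf₃ s)

onEdges? : {P : Fin n → Fin n → Set} → (∀ x y → Dec (P x y)) → ∀ s → Dec (OnEdges P s)
onEdges? P? s = P? (centre s) (leaf₁ s) ×-dec P? (centre s) (leaf₂ s) ×-dec P? (centre s) (leaf₃ s)

onEdges : {P : Fin n → Fin n → Set} → Symmetric P → ∀ s → OnEdges P s → EdgeOf x y s → P x y
onEdges P-sym _ (p , _ , _) (inj₁ (refl , inj₁ refl))         = p
onEdges P-sym _ (_ , p , _) (inj₁ (refl , inj₂ (inj₁ refl))) = p
onEdges P-sym _ (_ , _ , p) (inj₁ (refl , inj₂ (inj₂ refl))) = p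
onEdges P-sym _ (p , _ , _) (inj₂ (refl , inj₁ refl))         = P-sym p
onEdges P-sym _ (_ , p , _) (inj₂ (refl , inj₂ (inj₁ refl))) = P-sym p
onEdges P-sym _ (_ , _ , p) (inj₂ (refl , inj₂ (inj₂ refl))) = P-sym p

edgeOf-sym : EdgeOf x y s → EdgeOf y x s
edgeOf-sym = Sum.swap

edgeOf⇒≢ : ∀ s → EdgeOf x y s → x ≢ y
edgeOf⇒≢ s = onEdges {P = _≢_} (_∘ sym) s (c≢1 s , c≢2 s , c≢3 s)

module _ {e : Fin m → Fin n} (e-injective : Injective _≡_ _≡_ e) where

  mapStar : Star m → Star n
  mapStar s = record
    { centre = e (centre s) ; leaf₁ = e (leaf₁ s) ; leaf₂ = e (leaf₂ s) ; leaf₃ = e (leaf₃ s)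
    ; c≢1 = c≢1 s ∘ e-injective ; c≢2 = c≢2 s ∘ e-injective ; c≢3 = c≢3 s ∘ e-injective
    ; 1≢2 = 1≢2 s ∘ e-injective ; 1≢3 = 1≢3 s ∘ e-injective ; 2≢3 = 2≢3 s ∘ e-injective }

  isLeaf-map⁺ : ∀ {a} (s : Star m) → IsLeaf a s → IsLeaf (e a) (mapStar s)
  isLeaf-map⁺ _ (inj₁ refl)        = inj₁ refl
  isLeaf-map⁺ _ (inj₂ (inj₁ refl)) = inj₂ (inj₁ refl)
  isLeaf-map⁺ _ (inj₂ (inj₂ refl)) = inj₂ (inj₂ refl)

  edgeOf-map⁺ : ∀ {a b} (s : Star m) → EdgeOf a b s → EdgeOf (e a) (e b) (mapStar s)
  edgeOf-map⁺ s (inj₁ (refl , b-leaf)) = inj₁ (refl , isLeaf-map⁺ s b-leaf)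
  edgeOf-map⁺ s (inj₂ (refl , a-leaf)) = inj₂ (refl , isLeaf-map⁺ s a-leaf)

  isLeaf-map⁻ : ∀ {v} (s : Star m) → IsLeaf v (mapStar s) → ∃ λ a → e a ≡ v × IsLeaf a s
  isLeaf-map⁻ _ (inj₁ v≡)        = _ , sym v≡ , inj₁ refl
  isLeaf-map⁻ _ (inj₂ (inj₁ v≡)) = _ , sym v≡ , inj₂ (inj₁ refl)
  isLeaf-map⁻ _ (inj₂ (inj₂ v≡)) = _ , sym v≡ , inj₂ (inj₂ refl)

  vertexOf-map⁻ : ∀ {v} (s : Star m) → VertexOf v (mapStar s) → ∃ λ a → e a ≡ v × VertexOf a s
  vertexOf-map⁻ _ (inj₁ v≡)   = _ , sym v≡ , inj₁ refl
  vertexOf-map⁻ s (inj₂ leaf) with isLeaf-map⁻ s leaf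
  ... | a , ea≡v , a-leaf = a , ea≡v , inj₂ a-leaf

  edgeOf-map⁻ : ∀ {x y} (s : Star m) → EdgeOf x y (mapStar s) →
                ∃₂ λ a b → e a ≡ x × e b ≡ y × EdgeOf a b s
  edgeOf-map⁻ s (inj₁ (x≡ , leaf)) with isLeaf-map⁻ s leaf
  ... | b , eb≡y , b-leaf = _ , b , sym x≡ , eb≡y , inj₁ (refl , b-leaf)
  edgeOf-map⁻ s (inj₂ (y≡ , leaf)) with isLeaf-map⁻ s leaf
  ... | a , ea≡x , a-leaf = a , _ , ea≡x , sym y≡ , inj₂ (refl , a-leaf)

  vertexDisjoint-map : (s t : Star m) → VertexDisjoint s t → VertexDisjoint (mapStar s) (mapStar t)
  vertexDisjoint-map s t s#t v v∈s v∈t with vertexOf-map⁻ s v∈s | vertexOf-map⁻ t v∈t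
  ... | a , refl , a∈s | b , eb≡ea , b∈t with e-injective eb≡ea
  ... | refl = s#t a a∈s b∈t

-- Star decompositions and proper colourings

record IsStarDecomposition {I : Set} (G : Fin n → Fin n → Set) (B : I → Star n) : Set where
  field
    edge⇒adjacent : ∀ i → EdgeOf x y (B i) → G x y
    cover         : G x y → ∃ λ i → EdgeOf x y (B i)
    unique        : ∀ {i j} → EdgeOf x y (B i) → EdgeOf x y (B j) → i ≡ j

IsProperColouring : {I C : Set} → (I → Star n) → (I → C) → Set
IsProperColouring B colour = ∀ i j → i ≢ j → colour i ≡ colour j → VertexDisjoint (B i) (B j)

Image : {X : Set} → (A → X) → (A → A → Set) → X → X → Set
Image e G x y = ∃₂ λ a b → e a ≡ x × e b ≡ y × G a b

module _ {I : Set} {B : I → Star m} {e : Fin m → Fin n} (e-injective : Injective _≡_ _≡_ e) where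

  decomposition-map : {G : Fin m → Fin m → Set} → IsStarDecomposition G B →
                      IsStarDecomposition (Image e G) (mapStar e-injective ∘ B)
  decomposition-map {G} dec = record
    { edge⇒adjacent = λ i xy∈Bi → adjacent i (edgeOf-map⁻ e-injective (B i) xy∈Bi)
    ; cover = λ { (a , b , refl , refl , Gab) →
                  let (i , ab∈Bi) = cover Gab in i , edgeOf-map⁺ e-injective (B i) ab∈Bi }
    ; unique = λ {_} {_} {i} {j} xy∈Bi xy∈Bj →
                 same (edgeOf-map⁻ e-injective (B i) xy∈Bi) (edgeOf-map⁻ e-injective (B j) xy∈Bj)
    }
    where
    open IsStarDecomposition dec
    Preimage : I → Fin n → Fin n → Set
    Preimage i x y = ∃₂ λ a b → e a ≡ x × e b ≡ y × EdgeOf a b (B i)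
    adjacent : ∀ i {x y} → Preimage i x y → Image e G x y
    adjacent i (a , b , ea≡x , eb≡y , ab∈Bi) = a , b , ea≡x , eb≡y , edge⇒adjacent i ab∈Bi
    same : ∀ {i j x y} → Preimage i x y → Preimage j x y → i ≡ j
    same (a , b , refl , refl , ab∈Bi) (a′ , b′ , ea′≡ea , eb′≡eb , a′b′∈Bj)
      with e-injective ea′≡ea | e-injective eb′≡eb
    ... | refl | refl = unique ab∈Bi a′b′∈Bj

  proper-map : ∀ {C} {colour : I → C} → IsProperColouring B colour →
               IsProperColouring (mapStar e-injective ∘ B) colour
  proper-map proper i j i≢j same = vertexDisjoint-map e-injective (B i) (B j) (proper i j i≢j same)

proper-recolour : ∀ {I C D : Set} {B : I → Star n} {colour : I → C} {κ : C → D} →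
                  Injective _≡_ _≡_ κ → IsProperColouring B colour → IsProperColouring B (κ ∘ colour)
proper-recolour κ-injective proper i j i≢j same = proper i j i≢j (κ-injective same)

module _ {K : Set} {I : K → Set} {B : ∀ k → I k → Star n} where

  decomposition-⋃ : {G : K → Fin n → Fin n → Set} (part : Fin n → Fin n → K) →
    (∀ k → IsStarDecomposition (G k) (B k)) →
    (∀ {k x y} → G k x y → part x y ≡ k) → (∀ {x y} → x ≢ y → G (part x y) x y) →
    IsStarDecomposition _≢_ (uncurry B)
  decomposition-⋃ {G} part dec part-correct complete = record
    { edge⇒adjacent = λ (k , i) → edgeOf⇒≢ (B k i)
    ; cover = λ x≢y → let (i , xy∈Bi) = cover (complete x≢y) in (_ , i) , xy∈Bi
    ; unique = same
    }
    where
    open module Piece {k} = IsStarDecomposition (dec k)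
    same : ∀ {i j x y} → EdgeOf x y (uncurry B i) → EdgeOf x y (uncurry B j) → i ≡ j
    same {k , i} {_ , j} xy∈Bi xy∈Bj
      with trans (sym (part-correct (edge⇒adjacent i xy∈Bi))) (part-correct (edge⇒adjacent j xy∈Bj))
    ... | refl = cong (k ,_) (unique xy∈Bi xy∈Bj)

  proper-⋃ : ∀ {C} {colour : ∀ k → I k → C} → (∀ k → IsProperColouring (B k) (colour k)) →
    (∀ {k k′ i j v} → colour k i ≡ colour k′ j →
                      VertexOf v (B k i) → VertexOf v (B k′ j) → k ≡ k′) →
    IsProperColouring (uncurry B) (uncurry colour)
  proper-⋃ proper same-part (k , i) (_ , j) i≢j same v v∈Bi v∈Bj
    with same-part same v∈Bi v∈Bj
  ... | refl = proper k i j (i≢j ∘ cong (k ,_)) same v v∈Bi v∈Bj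

module _ {I : Set} {B : I → Star n} (ψ : Fin m ↔ I) where
  open Inverse ψ

  starSystem : IsStarDecomposition _≢_ B → IsStarSystem n m (B ∘ to)
  starSystem dec x y x≢y =
    from i , subst (λ i → EdgeOf x y (B i)) (sym (strictlyInverseˡ i)) xy∈Bi ,
    λ j xy∈Bj → trans (sym (strictlyInverseʳ j)) (cong from (unique xy∈Bj xy∈Bi))
    where
    open IsStarDecomposition dec
    i = proj₁ (cover x≢y)
    xy∈Bi = proj₂ (cover x≢y)

  blockColouring : ∀ {C k} {colour : I → C} (χ : Fin k ↔ C) → (∀ c → ∃ λ i → colour i ≡ c) →
                   IsProperColouring B colour → IsBlockColouring (B ∘ to) k (Inverse.from χ ∘ colour ∘ to)
  blockColouring {colour = colour} χ surjective proper = onto , disjoint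
    where
    module χ = Inverse χ
    onto : ∀ c → ∃ λ j → χ.from (colour (to j)) ≡ c
    onto c with surjective (χ.to c)
    ... | i , colour-i≡ = from i ,
      trans (cong (χ.from ∘ colour) (strictlyInverseˡ i))
            (trans (cong χ.from colour-i≡) (χ.strictlyInverseʳ c))
    disjoint : ∀ i j → i ≢ j → χ.from (colour (to i)) ≡ χ.from (colour (to j)) →
               VertexDisjoint (B (to i)) (B (to j))
    disjoint i j i≢j same = proper (to i) (to j)
      (λ eq → i≢j (trans (sym (strictlyInverseʳ i)) (trans (cong from eq) (strictlyInverseʳ j))))
      (trans (sym (χ.strictlyInverseˡ _)) (trans (cong χ.to same) (χ.strictlyInverseˡ _)))

Finite : Set → Set
Finite A = ∃ λ m → Fin m ↔ A

finite-⊎ : Finite A → Finite B → Finite (A ⊎ B)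
finite-⊎ (m , f) (n , g) = m + n , ↔-trans +↔⊎ (f ⊎-↔ g)

Σ-Fin-suc : {F : Fin (suc m) → Set} → Σ (Fin (suc m)) F ↔ (F zero ⊎ Σ (Fin m) (F ∘ suc))
Σ-Fin-suc = mk↔ₛ′
  (λ { (zero , x) → inj₁ x ; (suc i , x) → inj₂ (i , x) })
  [ (zero ,_) , (λ (i , x) → suc i , x) ]′
  (λ { (inj₁ _) → refl ; (inj₂ _) → refl })
  (λ { (zero , _) → refl ; (suc _ , _) → refl })

finite-Σ-Fin : ∀ m {F : Fin m → Set} → (∀ i → Finite (F i)) → Finite (Σ (Fin m) F)
finite-Σ-Fin zero    _      = 0 , mk↔ₛ′ (λ ()) (λ ()) (λ ()) (λ ())
finite-Σ-Fin (suc m) finite with finite-⊎ (finite zero) (finite-Σ-Fin m (finite ∘ suc))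
... | k , f = k , ↔-trans f (↔-sym Σ-Fin-suc)

finite-Σ : {F : A → Set} → Finite A → (∀ a → Finite (F a)) → Finite (Σ A F)
finite-Σ (m , φ) finite with finite-Σ-Fin m (finite ∘ Inverse.to φ)
... | k , f = k , ↔-trans f (Σ-↔ φ ↔-refl)

finite-Fin : Finite (Fin n)
finite-Fin = _ , ↔-refl

blockColourableStarSystem : ∀ {k} {I C : Set} {B : I → Star n} {colour : I → C} →
  Finite I → Fin k ↔ C → IsStarDecomposition _≢_ B → IsProperColouring B colour →
  (∀ c → ∃ λ i → colour i ≡ c) →
  Σ ℕ λ m → Σ (Fin m → Star n) λ B′ → IsStarSystem n m B′ × BlockColourable B′ k
blockColourableStarSystem {B = B} {colour} (m , ψ) χ dec proper surjective =
  m , B ∘ Inverse.to ψ , starSystem ψ dec , _ , blockColouring {B = B} ψ {colour = colour} χ surjective proper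

-- Complete bipartite graphs and embeddings of Fin (p + q)

data Opposite {A B : Set} : A ⊎ B → A ⊎ B → Set where
  left-right : {a : A} {b : B} → Opposite (inj₁ a) (inj₂ b)
  right-left : {a : A} {b : B} → Opposite (inj₂ b) (inj₁ a)

opposite-sym : Symmetric (Opposite {A} {B})
opposite-sym left-right = right-left
opposite-sym right-left = left-right

opposite? : (u w : A ⊎ B) → Dec (Opposite u w)
opposite? (inj₁ _) (inj₁ _) = no λ ()
opposite? (inj₁ _) (inj₂ _) = yes left-right
opposite? (inj₂ _) (inj₁ _) = yes right-left
opposite? (inj₂ _) (inj₂ _) = no λ ()

Bipartite : ∀ p → Fin (p + q) → Fin (p + q) → Set
Bipartite p a b = Opposite (splitAt p a) (splitAt p b)

++-injective : {f : Fin p → A} {g : Fin q → A} →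
  Injective _≡_ _≡_ f → Injective _≡_ _≡_ g → (∀ i j → f i ≢ g j) → Injective _≡_ _≡_ (f ++ g)
++-injective {p = p} {q = q} {f = f} {g} f-injective g-injective f≢g {a} {b} eq =
  trans (sym (join-splitAt p q a)) (trans (cong (join p q) (sides (splitAt p a) (splitAt p b) eq)) (join-splitAt p q b))
  where
  sides : ∀ u w → [ f , g ]′ u ≡ [ f , g ]′ w → u ≡ w
  sides (inj₁ i) (inj₁ j) eq = cong inj₁ (f-injective eq)
  sides (inj₁ i) (inj₂ j) eq = contradiction eq (f≢g i j)
  sides (inj₂ i) (inj₁ j) eq = contradiction (sym eq) (f≢g j i)
  sides (inj₂ i) (inj₂ j) eq = cong inj₂ (g-injective eq)

image-++ : {f : Fin p → A} {g : Fin q → A} {G : Fin (p + q) → Fin (p + q) → Set} →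
  ∀ u w → G (join p q u) (join p q w) → Image (f ++ g) G ([ f , g ]′ u) ([ f , g ]′ w)
image-++ {p = p} {q = q} {f = f} {g} u w G-uw =
  join p q u , join p q w , cong [ f , g ]′ (splitAt-join p q u) , cong [ f , g ]′ (splitAt-join p q w) , G-uw

++-avoids : {f : Fin m → A} {g : Fin p → A} {h : Fin q → A} →
  (∀ i j → f i ≢ g j) → (∀ i j → f i ≢ h j) → ∀ i j → f i ≢ (g ++ h) j
++-avoids {p = p} {f = f} {g} {h} f≢g f≢h i j = avoids (splitAt p j)
  where
  avoids : ∀ u → f i ≢ [ g , h ]′ u
  avoids (inj₁ k) = f≢g i k
  avoids (inj₂ k) = f≢h i k

image-++-complete : {f : Fin p → A} {g : Fin q → A} → ∀ u w →
  [ f , g ]′ u ≢ [ f , g ]′ w → Image (f ++ g) _≢_ ([ f , g ]′ u) ([ f , g ]′ w)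
image-++-complete {p = p} {q = q} {f = f} {g} u w u≢w = image-++ u w λ eq →
  u≢w (cong [ f , g ]′ (trans (sym (splitAt-join p q u)) (trans (cong (splitAt p) eq) (splitAt-join p q w))))

image-++-bipartite : {f : Fin p → A} {g : Fin q → A} {u w : Fin p ⊎ Fin q} →
  Opposite u w → Image (f ++ g) (Bipartite p) ([ f , g ]′ u) ([ f , g ]′ w)
image-++-bipartite {p = p} {q = q} {u = u} {w} u⇹w =
  image-++ u w (subst₂ Opposite (sym (splitAt-join p q u)) (sym (splitAt-join p q w)) u⇹w)

-- Designs given by tables of colour classes

module ColourClasses {V k : ℕ} (classes : Vec (List (Star V)) k) where

  class : Fin k → List (Star V)
  class = Vec.lookup classes

  Block : Set
  Block = Σ (Fin k) (Fin ∘ length ∘ class)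

  star : Block → Star V
  star (c , i) = List.lookup (class c) i

  colour : Block → Fin k
  colour = proj₁

  private
    all-blocks? : {P : Block → Set} → (∀ β → Dec (P β)) → Dec (∀ β → P β)
    all-blocks? P? = map′ uncurry curry (all? λ c → all? λ i → P? (c , i))

    any-block? : {P : Block → Set} → (∀ β → Dec (P β)) → Dec (∃ P)
    any-block? P? = map′ (λ (c , i , p) → (c , i) , p) (λ ((c , i) , p) → c , i , p)
                         (any? λ c → any? λ i → P? (c , i))

    _≟-block_ : DecidableEquality Block
    _≟-block_ = ≡-dec _≟_ _≟_

  Determines : Block → Fin V → Fin V → Set
  Determines β x y = ∀ β′ → EdgeOf x y (star β′) → β′ ≡ β

  determines-sym : ∀ {β} → Symmetric (Determines β)
  determines-sym det β′ = det β′ ∘ edgeOf-sym {s = star β′}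

  IsCertified : (Fin V → Fin V → Set) → Set
  IsCertified G =
      (∀ a b → G a b → ∃ λ β → EdgeOf a b (star β))
    × (∀ β → OnEdges G (star β))
    × (∀ β → OnEdges (Determines β) (star β))
    × (∀ c i j → i ≢ j → VertexDisjoint (List.lookup (class c) i) (List.lookup (class c) j))

  certified? : {G : Fin V → Fin V → Set} → (∀ a b → Dec (G a b)) → Dec (IsCertified G)
  certified? G? =
        (all? λ a → all? λ b → G? a b →-dec any-block? λ β → edgeOf? a b (star β))
    ×-dec all-blocks? (onEdges? G? ∘ star)
    ×-dec all-blocks? (λ β → onEdges? (λ x y → all-blocks? λ β′ →
                                         edgeOf? x y (star β′) →-dec (β′ ≟-block β)) (star β))
    ×-dec (all? λ c → all? λ i → all? λ j → ¬? (i ≟ j) →-dec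
             vertexDisjoint? (List.lookup (class c) i) (List.lookup (class c) j))

  decomposition : {G : Fin V → Fin V → Set} → Symmetric G → IsCertified G → IsStarDecomposition G star
  decomposition G-sym (covers , edges-in , determined , _) = record
    { edge⇒adjacent = λ β → onEdges G-sym (star β) (edges-in β)
    ; cover = λ {x} {y} → covers x y
    ; unique = λ {_} {_} {β} {β′} xy∈β xy∈β′ →
                 onEdges determines-sym (star β′) (determined β′) xy∈β′ β xy∈β
    }

  proper : {G : Fin V → Fin V → Set} → IsCertified G → IsProperColouring star colour
  proper (_ , _ , _ , classes-disjoint) (c , i) (_ , j) β≢β′ refl =
    classes-disjoint c i j (β≢β′ ∘ cong (c ,_))

  nonempty? : Dec (∀ c → 0 < length (class c))
  nonempty? = all? λ c → 0 <? length (class c)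

  surjective : (∀ c → 0 < length (class c)) → ∀ c → ∃ λ β → colour β ≡ c
  surjective nonempty c = (c , fromℕ< (nonempty c)) , refl

  finite : Finite Block
  finite = finite-Σ finite-Fin λ _ → finite-Fin

record ColouredDesign : Set₁ where
  field
    order colours : ℕ
    Adjacent      : Fin order → Fin order → Set
    Block         : Set
    star          : Block → Star order
    colour        : Block → Fin colours
    finite        : Finite Block
    decomposition : IsStarDecomposition Adjacent star
    proper        : IsProperColouring star colour

colouredDesign : ∀ {V k} (classes : Vec (List (Star V)) k) {G : Fin V → Fin V → Set} →
                 Symmetric G → ColourClasses.IsCertified classes G → ColouredDesign
colouredDesign {V} {k} classes {G} G-sym certificate = record
  { order = V ; colours = k ; Adjacent = G ; Block = Block ; star = star ; colour = colour
  ; finite = finite ; decomposition = decomposition G-sym certificate ; proper = proper certificate }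
  where open ColourClasses classes

-- The cyclic group ℤ_t and unordered pairs of groups

module CyclicGroup (t′ : ℕ) where

  t : ℕ
  t = suc t′

  infixl 6 _⊕_ _⊖_

  _⊕_ : Fin t → Fin t → Fin t
  g ⊕ h = (toℕ g + toℕ h) mod t

  _⊖_ : Fin t → Fin t → Fin t
  g ⊖ h = (toℕ g + (t ∸ toℕ h)) mod t

  toℕ-mod : ∀ a → toℕ (a mod t) ≡ a % t
  toℕ-mod a = toℕ-fromℕ< (m%n<n a t)

  ⊕-comm : ∀ g h → g ⊕ h ≡ h ⊕ g
  ⊕-comm g h = cong (_mod t) (+-comm (toℕ g) (toℕ h))

  ⊕-identityˡ : ∀ h → zero ⊕ h ≡ h
  ⊕-identityˡ h = toℕ-injective (trans (toℕ-mod (toℕ h)) (m<n⇒m%n≡m (toℕ<n h)))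

  [a%t+b]%t≡[a+b]%t : ∀ a b → (a % t + b) % t ≡ (a + b) % t
  [a%t+b]%t≡[a+b]%t a b = begin
    (a % t + b) % t          ≡⟨ %-distribˡ-+ (a % t) b t ⟩
    (a % t % t + b % t) % t  ≡⟨ cong (λ r → (r + b % t) % t) (m%n%n≡m%n a t) ⟩
    (a % t + b % t) % t      ≡⟨ %-distribˡ-+ a b t ⟨
    (a + b) % t              ∎
    where open ≡-Reasoning

  ⊕-⊖-cancel : ∀ g h → (g ⊕ h) ⊖ g ≡ h
  ⊕-⊖-cancel g h = toℕ-injective (begin
    toℕ ((g ⊕ h) ⊖ g)              ≡⟨ toℕ-mod (toℕ (g ⊕ h) + (t ∸ a)) ⟩
    (toℕ (g ⊕ h) + (t ∸ a)) % t    ≡⟨ cong (λ r → (r + (t ∸ a)) % t) (toℕ-mod (a + b)) ⟩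
    ((a + b) % t + (t ∸ a)) % t    ≡⟨ [a%t+b]%t≡[a+b]%t (a + b) (t ∸ a) ⟩
    (a + b + (t ∸ a)) % t          ≡⟨ cong (_% t) (+-assoc a b (t ∸ a)) ⟩
    (a + (b + (t ∸ a))) % t        ≡⟨ cong (λ r → (a + r) % t) (+-comm b (t ∸ a)) ⟩
    (a + ((t ∸ a) + b)) % t        ≡⟨ cong (_% t) (+-assoc a (t ∸ a) b) ⟨
    (a + (t ∸ a) + b) % t          ≡⟨ cong (λ r → (r + b) % t) (m+[n∸m]≡n (<⇒≤ (toℕ<n g))) ⟩
    (t + b) % t                    ≡⟨ cong (_% t) (+-comm t b) ⟩
    (b + t) % t                    ≡⟨ [m+n]%n≡m%n b t ⟩
    b % t                          ≡⟨ m<n⇒m%n≡m (toℕ<n h) ⟩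
    b                              ∎)
    where
    open ≡-Reasoning
    a = toℕ g
    b = toℕ h

-- inj₂ j is the pair {0, j + 1}; inj₁ p is the pair p with both elements shifted up by one.
Pair : ℕ → Set
Pair zero    = ⊥
Pair (suc t) = Pair t ⊎ Fin t

lo hi : ∀ {t} → Pair t → Fin t
lo {suc t} (inj₁ p) = suc (lo p)
lo {suc t} (inj₂ j) = zero
hi {suc t} (inj₁ p) = suc (hi p)
hi {suc t} (inj₂ j) = suc j

lo≢hi : ∀ {t} (p : Pair t) → lo p ≢ hi p
lo≢hi {suc t} (inj₁ p) = lo≢hi p ∘ suc-injective
lo≢hi {suc t} (inj₂ j) ()

finite-Pair : ∀ t → Finite (Pair t)
finite-Pair zero    = 0 , 0↔⊥
finite-Pair (suc t) = finite-⊎ (finite-Pair t) finite-Fin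

pairOrDiagonal : ∀ {t} → Fin t → Fin t → Pair t ⊎ Fin t
pairOrDiagonal zero    zero    = inj₂ zero
pairOrDiagonal zero    (suc j) = inj₁ (inj₂ j)
pairOrDiagonal (suc i) zero    = inj₁ (inj₂ i)
pairOrDiagonal (suc i) (suc j) = Sum.map inj₁ suc (pairOrDiagonal i j)

pairOrDiagonal-diag : ∀ {t} (i : Fin t) → pairOrDiagonal i i ≡ inj₂ i
pairOrDiagonal-diag zero    = refl
pairOrDiagonal-diag (suc i) = cong (Sum.map inj₁ suc) (pairOrDiagonal-diag i)

pairOrDiagonal-lo-hi : ∀ {t} (p : Pair t) → pairOrDiagonal (lo p) (hi p) ≡ inj₁ p
pairOrDiagonal-lo-hi {suc t} (inj₁ p) = cong (Sum.map inj₁ suc) (pairOrDiagonal-lo-hi p)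
pairOrDiagonal-lo-hi {suc t} (inj₂ j) = refl

pairOrDiagonal-hi-lo : ∀ {t} (p : Pair t) → pairOrDiagonal (hi p) (lo p) ≡ inj₁ p
pairOrDiagonal-hi-lo {suc t} (inj₁ p) = cong (Sum.map inj₁ suc) (pairOrDiagonal-hi-lo p)
pairOrDiagonal-hi-lo {suc t} (inj₂ j) = refl

pairOrDiagonal≡inj₂⇒ : ∀ {t} {i j d : Fin t} → pairOrDiagonal i j ≡ inj₂ d → i ≡ d × j ≡ d
pairOrDiagonal≡inj₂⇒ {i = zero}  {zero}  refl = refl , refl
pairOrDiagonal≡inj₂⇒ {i = suc i} {suc j} eq with pairOrDiagonal i j in ij
pairOrDiagonal≡inj₂⇒ {i = suc i} {suc j} refl | inj₂ _ with pairOrDiagonal≡inj₂⇒ {i = i} {j} ij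
... | refl , refl = refl , refl

pairOrDiagonal≡inj₁⇒ : ∀ {t} {i j : Fin t} {p} → pairOrDiagonal i j ≡ inj₁ p →
                 (i ≡ lo p × j ≡ hi p) ⊎ (i ≡ hi p × j ≡ lo p)
pairOrDiagonal≡inj₁⇒ {i = zero}  {suc j} refl = inj₁ (refl , refl)
pairOrDiagonal≡inj₁⇒ {i = suc i} {zero}  refl = inj₂ (refl , refl)
pairOrDiagonal≡inj₁⇒ {i = suc i} {suc j} eq with pairOrDiagonal i j in ij
pairOrDiagonal≡inj₁⇒ {i = suc i} {suc j} refl | inj₁ _ with pairOrDiagonal≡inj₁⇒ {i = i} {j} ij
... | inj₁ (refl , refl) = inj₁ (refl , refl)
... | inj₂ (refl , refl) = inj₂ (refl , refl)

-- The four small designs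

module Tables where
  open import Agda.Builtin.FromNat using (fromNat)
  open import Data.List using ([]; _∷_)
  open import Data.Vec using ([]; _∷_)

  instance
    finNumber : Number (Fin n)
    finNumber {n} = Fin.number n

    natNumber : Number ℕ
    natNumber = ℕ.number

  k15 : Vec (List (Star 15)) 14
  k15 =
    (⟨ 8 ∣ 0 , 1 , 12 ⟩ ∷ ⟨ 3 ∣ 4 , 5 , 14 ⟩ ∷ ⟨ 13 ∣ 6 , 7 , 10 ⟩ ∷ []) ∷
    (⟨ 14 ∣ 0 , 2 , 12 ⟩ ∷ ⟨ 11 ∣ 1 , 9 , 10 ⟩ ∷ ⟨ 6 ∣ 3 , 5 , 8 ⟩ ∷ []) ∷
    (⟨ 10 ∣ 1 , 2 , 7 ⟩ ∷ ⟨ 12 ∣ 5 , 9 , 11 ⟩ ∷ []) ∷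
    (⟨ 11 ∣ 0 , 2 , 6 ⟩ ∷ ⟨ 5 ∣ 1 , 7 , 8 ⟩ ∷ ⟨ 10 ∣ 9 , 12 , 14 ⟩ ∷ []) ∷
    (⟨ 9 ∣ 1 , 2 , 8 ⟩ ∷ ⟨ 7 ∣ 3 , 6 , 12 ⟩ ∷ ⟨ 5 ∣ 10 , 11 , 14 ⟩ ∷ []) ∷
    (⟨ 1 ∣ 0 , 2 , 3 ⟩ ∷ ⟨ 4 ∣ 5 , 12 , 14 ⟩ ∷ []) ∷
    (⟨ 0 ∣ 5 , 6 , 9 ⟩ ∷ ⟨ 1 ∣ 4 , 12 , 13 ⟩ ∷ []) ∷
    (⟨ 2 ∣ 0 , 5 , 7 ⟩ ∷ ⟨ 6 ∣ 1 , 12 , 14 ⟩ ∷ ⟨ 11 ∣ 4 , 8 , 13 ⟩ ∷ []) ∷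
    (⟨ 7 ∣ 0 , 1 , 9 ⟩ ∷ ⟨ 4 ∣ 2 , 6 , 10 ⟩ ∷ ⟨ 13 ∣ 3 , 12 , 14 ⟩ ∷ []) ∷
    (⟨ 2 ∣ 6 , 12 , 13 ⟩ ∷ ⟨ 8 ∣ 3 , 4 , 10 ⟩ ∷ []) ∷
    (⟨ 10 ∣ 0 , 3 , 6 ⟩ ∷ ⟨ 7 ∣ 4 , 11 , 14 ⟩ ∷ []) ∷
    (⟨ 8 ∣ 2 , 7 , 13 ⟩ ∷ ⟨ 9 ∣ 3 , 4 , 14 ⟩ ∷ []) ∷
    (⟨ 13 ∣ 0 , 4 , 5 ⟩ ∷ ⟨ 3 ∣ 2 , 11 , 12 ⟩ ∷ []) ∷
    (⟨ 0 ∣ 3 , 4 , 12 ⟩ ∷ ⟨ 14 ∣ 1 , 8 , 11 ⟩ ∷ ⟨ 9 ∣ 5 , 6 , 13 ⟩ ∷ []) ∷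
    []

  k3-12 : Vec (List (Star 15)) 4
  k3-12 =
    (⟨ 0 ∣ 3 , 4 , 5 ⟩ ∷ ⟨ 1 ∣ 6 , 7 , 8 ⟩ ∷ ⟨ 2 ∣ 9 , 10 , 11 ⟩ ∷ []) ∷
    (⟨ 0 ∣ 6 , 7 , 8 ⟩ ∷ ⟨ 1 ∣ 9 , 10 , 11 ⟩ ∷ ⟨ 2 ∣ 12 , 13 , 14 ⟩ ∷ []) ∷
    (⟨ 0 ∣ 9 , 10 , 11 ⟩ ∷ ⟨ 1 ∣ 12 , 13 , 14 ⟩ ∷ ⟨ 2 ∣ 3 , 4 , 5 ⟩ ∷ []) ∷
    (⟨ 0 ∣ 12 , 13 , 14 ⟩ ∷ ⟨ 1 ∣ 3 , 4 , 5 ⟩ ∷ ⟨ 2 ∣ 6 , 7 , 8 ⟩ ∷ []) ∷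
    []

  k12 : Vec (List (Star 12)) 14
  k12 =
    (⟨ 2 ∣ 0 , 5 , 9 ⟩ ∷ ⟨ 8 ∣ 3 , 4 , 11 ⟩ ∷ []) ∷
    (⟨ 8 ∣ 0 , 1 , 2 ⟩ ∷ ⟨ 6 ∣ 4 , 5 , 11 ⟩ ∷ []) ∷
    (⟨ 6 ∣ 0 , 1 , 8 ⟩ ∷ ⟨ 4 ∣ 2 , 3 , 11 ⟩ ∷ []) ∷
    (⟨ 7 ∣ 0 , 2 , 4 ⟩ ∷ ⟨ 10 ∣ 6 , 8 , 11 ⟩ ∷ []) ∷
    (⟨ 9 ∣ 0 , 3 , 7 ⟩ ∷ ⟨ 10 ∣ 1 , 2 , 4 ⟩ ∷ []) ∷
    (⟨ 5 ∣ 0 , 3 , 10 ⟩ ∷ ⟨ 6 ∣ 2 , 7 , 9 ⟩ ∷ []) ∷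
    (⟨ 11 ∣ 0 , 2 , 3 ⟩ ∷ ⟨ 4 ∣ 1 , 5 , 9 ⟩ ∷ []) ∷
    (⟨ 1 ∣ 0 , 9 , 11 ⟩ ∷ ⟨ 7 ∣ 3 , 5 , 10 ⟩ ∷ []) ∷
    (⟨ 7 ∣ 1 , 8 , 11 ⟩ ∷ ⟨ 3 ∣ 2 , 6 , 10 ⟩ ∷ []) ∷
    (⟨ 1 ∣ 2 , 3 , 5 ⟩ ∷ ⟨ 9 ∣ 8 , 10 , 11 ⟩ ∷ []) ∷
    (⟨ 0 ∣ 3 , 4 , 10 ⟩ ∷ ⟨ 5 ∣ 8 , 9 , 11 ⟩ ∷ []) ∷
    [] ∷
    [] ∷
    [] ∷
    []

  k12-12 : Vec (List (Star 24)) 8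
  k12-12 =
    (⟨ 17 ∣ 0 , 7 , 9 ⟩ ∷ ⟨ 22 ∣ 1 , 4 , 6 ⟩ ∷ ⟨ 18 ∣ 2 , 8 , 10 ⟩ ∷
     ⟨ 3 ∣ 13 , 15 , 21 ⟩ ∷ ⟨ 5 ∣ 16 , 19 , 23 ⟩ ∷ ⟨ 11 ∣ 12 , 14 , 20 ⟩ ∷ []) ∷
    (⟨ 0 ∣ 19 , 21 , 23 ⟩ ∷ ⟨ 1 ∣ 13 , 14 , 16 ⟩ ∷ ⟨ 22 ∣ 2 , 5 , 9 ⟩ ∷
     ⟨ 18 ∣ 3 , 7 , 11 ⟩ ∷ ⟨ 20 ∣ 4 , 6 , 8 ⟩ ∷ ⟨ 10 ∣ 12 , 15 , 17 ⟩ ∷ []) ∷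
    (⟨ 20 ∣ 3 , 10 , 0 ⟩ ∷ ⟨ 13 ∣ 4 , 7 , 9 ⟩ ∷ ⟨ 21 ∣ 5 , 11 , 1 ⟩ ∷
     ⟨ 6 ∣ 16 , 18 , 12 ⟩ ∷ ⟨ 8 ∣ 19 , 22 , 14 ⟩ ∷ ⟨ 2 ∣ 15 , 17 , 23 ⟩ ∷ []) ∷
    (⟨ 3 ∣ 22 , 12 , 14 ⟩ ∷ ⟨ 4 ∣ 16 , 17 , 19 ⟩ ∷ ⟨ 13 ∣ 5 , 8 , 0 ⟩ ∷
     ⟨ 21 ∣ 6 , 10 , 2 ⟩ ∷ ⟨ 23 ∣ 7 , 9 , 11 ⟩ ∷ ⟨ 1 ∣ 15 , 18 , 20 ⟩ ∷ []) ∷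
    (⟨ 23 ∣ 6 , 1 , 3 ⟩ ∷ ⟨ 16 ∣ 7 , 10 , 0 ⟩ ∷ ⟨ 12 ∣ 8 , 2 , 4 ⟩ ∷
     ⟨ 9 ∣ 19 , 21 , 15 ⟩ ∷ ⟨ 11 ∣ 22 , 13 , 17 ⟩ ∷ ⟨ 5 ∣ 18 , 20 , 14 ⟩ ∷ []) ∷
    (⟨ 6 ∣ 13 , 15 , 17 ⟩ ∷ ⟨ 7 ∣ 19 , 20 , 22 ⟩ ∷ ⟨ 16 ∣ 8 , 11 , 3 ⟩ ∷
     ⟨ 12 ∣ 9 , 1 , 5 ⟩ ∷ ⟨ 14 ∣ 10 , 0 , 2 ⟩ ∷ ⟨ 4 ∣ 18 , 21 , 23 ⟩ ∷ []) ∷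
    (⟨ 14 ∣ 9 , 4 , 6 ⟩ ∷ ⟨ 19 ∣ 10 , 1 , 3 ⟩ ∷ ⟨ 15 ∣ 11 , 5 , 7 ⟩ ∷
     ⟨ 0 ∣ 22 , 12 , 18 ⟩ ∷ ⟨ 2 ∣ 13 , 16 , 20 ⟩ ∷ ⟨ 8 ∣ 21 , 23 , 17 ⟩ ∷ []) ∷
    (⟨ 9 ∣ 16 , 18 , 20 ⟩ ∷ ⟨ 10 ∣ 22 , 23 , 13 ⟩ ∷ ⟨ 19 ∣ 11 , 2 , 6 ⟩ ∷
     ⟨ 15 ∣ 0 , 4 , 8 ⟩ ∷ ⟨ 17 ∣ 1 , 3 , 5 ⟩ ∷ ⟨ 7 ∣ 21 , 12 , 14 ⟩ ∷ []) ∷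
    []

open Tables

complete? : ∀ (a b : Fin n) → Dec (a ≢ b)
complete? a b = ¬? (a ≟ b)

bipartite? : ∀ p (a b : Fin (p + q)) → Dec (Bipartite p a b)
bipartite? p a b = opposite? (splitAt p a) (splitAt p b)

K15 K3-12 K12 K12-12 : ColouredDesign
K15    = colouredDesign k15    ≢-sym       (from-yes (ColourClasses.certified? k15 complete?))
K3-12  = colouredDesign k3-12  opposite-sym (from-yes (ColourClasses.certified? k3-12 (bipartite? 3)))
K12    = colouredDesign k12    ≢-sym       (from-yes (ColourClasses.certified? k12 complete?))
K12-12 = colouredDesign k12-12 opposite-sym (from-yes (ColourClasses.certified? k12-12 (bipartite? 12)))

ColourSurjective : ColouredDesign → Set
ColourSurjective D = ∀ c → ∃ λ β → ColouredDesign.colour D β ≡ c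

K15-surjective : ColourSurjective K15
K15-surjective = ColourClasses.surjective k15 (from-yes (ColourClasses.nonempty? k15))

K3-12-surjective : ColourSurjective K3-12
K3-12-surjective = ColourClasses.surjective k3-12 (from-yes (ColourClasses.nonempty? k3-12))

K12-12-surjective : ColourSurjective K12-12
K12-12-surjective = ColourClasses.surjective k12-12 (from-yes (ColourClasses.nonempty? k12-12))

-- The construction for n = 12t + 3

module Construction (t′ : ℕ) where
  open CyclicGroup t′

  V : Set
  V = Fin 3 ⊎ (Fin t × Fin 12)

  vertices : Fin (3 + t * 12) ↔ V
  vertices = ↔-trans +↔⊎ (↔-refl ⊎-↔ *↔×)

  ∞ : Fin 3 → V
  ∞ = inj₁

  point : Fin t → Fin 12 → V
  point g y = inj₂ (g , y)

  group : V → Maybe (Fin t)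
  group (inj₁ _)       = nothing
  group (inj₂ (g , _)) = just g

  ∞-injective : Injective _≡_ _≡_ ∞
  ∞-injective refl = refl

  point-injective : ∀ g → Injective _≡_ _≡_ (point g)
  point-injective g refl = refl

  -- link g and clique g live on the group suc g; group zero belongs to the core.
  Part : Set
  Part = ⊤ ⊎ (Fin t′ ⊎ (Fin t′ ⊎ Pair t))

  pattern core     = inj₁ tt
  pattern link g   = inj₂ (inj₁ g)
  pattern clique g = inj₂ (inj₂ (inj₁ g))
  pattern bridge p = inj₂ (inj₂ (inj₂ p))

  data Colour : Set where
    global : Fin 2 → Colour
    latin  : Fin t → Fin 8 → Colour
    spoke  : Fin t → Fin 4 → Colour

  colours : Fin (2 + t * 12) ↔ Colour
  colours = ↔-trans +↔⊎ (↔-trans (↔-refl ⊎-↔ (↔-trans *↔× (↔-refl ×-↔ +↔⊎))) encoding)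
    where
    encoding : (Fin 2 ⊎ (Fin t × (Fin 8 ⊎ Fin 4))) ↔ Colour
    encoding = mk↔ₛ′
      [ global , (λ { (s , inj₁ k) → latin s k ; (g , inj₂ r) → spoke g r }) ]′
      (λ { (global e) → inj₁ e ; (latin s k) → inj₂ (s , inj₁ k) ; (spoke g r) → inj₂ (g , inj₂ r) })
      (λ { (global _) → refl ; (latin _ _) → refl ; (spoke _ _) → refl })
      (λ { (inj₁ _) → refl ; (inj₂ (_ , inj₁ _)) → refl ; (inj₂ (_ , inj₂ _)) → refl })

  design : Part → ColouredDesign
  design core       = K15
  design (link _)   = K3-12
  design (clique _) = K12
  design (bridge _) = K12-12

  module Design (k : Part) = ColouredDesign (design k)

  embed : ∀ k → Fin (Design.order k) → V
  embed core       = ∞ ++ point zero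
  embed (link g)   = ∞ ++ point (suc g)
  embed (clique g) = point (suc g)
  embed (bridge p) = point (lo p) ++ point (hi p)

  embed-injective : ∀ k → Injective _≡_ _≡_ (embed k)
  embed-injective core       = ++-injective ∞-injective (point-injective zero) λ _ _ ()
  embed-injective (link g)   = ++-injective ∞-injective (point-injective (suc g)) λ _ _ ()
  embed-injective (clique g) = point-injective (suc g)
  embed-injective (bridge p) = ++-injective (point-injective (lo p)) (point-injective (hi p))
    λ _ _ → lo≢hi p ∘ just-injective ∘ cong group

  diagonalColours : Fin t → Fin 14 → Colour
  diagonalColours d = latin (d ⊕ d) ++ (spoke zero ++ global)

  paint : ∀ k → Fin (Design.colours k) → Colour
  paint core       = diagonalColours zero
  paint (link g)   = spoke (suc g)
  paint (clique g) = diagonalColours (suc g)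
  paint (bridge p) = latin (lo p ⊕ hi p)

  diagonalColours-injective : ∀ d → Injective _≡_ _≡_ (diagonalColours d)
  diagonalColours-injective d =
    ++-injective {f = latin (d ⊕ d)} (λ { refl → refl })
      (++-injective {f = spoke zero} {g = global} (λ { refl → refl }) (λ { refl → refl }) λ _ _ ())
      (++-avoids {g = spoke zero} {h = global} (λ _ _ ()) (λ _ _ ()))

  paint-injective : ∀ k → Injective _≡_ _≡_ (paint k)
  paint-injective core       = diagonalColours-injective zero
  paint-injective (link g)   refl = refl
  paint-injective (clique g) = diagonalColours-injective (suc g)
  paint-injective (bridge p) refl = refl

  diagonal : Fin t → Part
  diagonal zero    = core
  diagonal (suc g) = clique g

  diagonalOf : Maybe (Fin t) → Part
  diagonalOf nothing  = core
  diagonalOf (just g) = diagonal g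

  linkOf : Fin t → Part
  linkOf zero    = core
  linkOf (suc g) = link g

  between : Fin t → Fin t → Part
  between g h = [ bridge , diagonal ]′ (pairOrDiagonal g h)

  between-diagonal : ∀ g → between g g ≡ diagonal g
  between-diagonal g = cong [ bridge , diagonal ]′ (pairOrDiagonal-diag g)

  between-lo-hi : ∀ p → between (lo p) (hi p) ≡ bridge p
  between-lo-hi p = cong [ bridge , diagonal ]′ (pairOrDiagonal-lo-hi p)

  between-hi-lo : ∀ p → between (hi p) (lo p) ≡ bridge p
  between-hi-lo p = cong [ bridge , diagonal ]′ (pairOrDiagonal-hi-lo p)

  edgePart : Maybe (Fin t) → Maybe (Fin t) → Part
  edgePart nothing  nothing  = core
  edgePart nothing  (just h) = linkOf h
  edgePart (just g) nothing  = linkOf g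
  edgePart (just g) (just h) = between g h

  -- The colour of a block and the group of any of its vertices determine the part of the block;
  -- for a latin colour of symbol s seen at group g the other group is s ⊖ g.
  colourPart : Colour → Maybe (Fin t) → Part
  colourPart (latin s _)       nothing  = core
  colourPart (latin s _)       (just g) = between g (s ⊖ g)
  colourPart (spoke zero _)    γ        = diagonalOf γ
  colourPart (spoke (suc g) _) _        = link g
  colourPart (global _)        γ        = diagonalOf γ

  edgePart-image : ∀ k {u w} → Image (embed k) (Design.Adjacent k) u w → edgePart (group u) (group w) ≡ k
  edgePart-image core (a , b , refl , refl , _) = core-edge (splitAt 3 a) (splitAt 3 b)
    where
    core-edge : ∀ u w → edgePart (group ([ ∞ , point zero ]′ u)) (group ([ ∞ , point zero ]′ w)) ≡ core
    core-edge (inj₁ _) (inj₁ _) = refl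
    core-edge (inj₁ _) (inj₂ _) = refl
    core-edge (inj₂ _) (inj₁ _) = refl
    core-edge (inj₂ _) (inj₂ _) = refl
  edgePart-image (link g) (a , b , refl , refl , a⇹b) = link-edge a⇹b
    where
    link-edge : ∀ {u w} → Opposite u w →
                edgePart (group ([ ∞ , point (suc g) ]′ u)) (group ([ ∞ , point (suc g) ]′ w)) ≡ link g
    link-edge left-right = refl
    link-edge right-left = refl
  edgePart-image (clique g) (_ , _ , refl , refl , _) = between-diagonal (suc g)
  edgePart-image (bridge p) (a , b , refl , refl , a⇹b) = bridge-edge a⇹b
    where
    bridge-edge : ∀ {u w} → Opposite u w →
      edgePart (group ([ point (lo p) , point (hi p) ]′ u)) (group ([ point (lo p) , point (hi p) ]′ w))
        ≡ bridge p
    bridge-edge left-right = between-lo-hi p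
    bridge-edge right-left = between-hi-lo p

  edgePart-cover : ∀ {u w} → u ≢ w →
    let k = edgePart (group u) (group w) in Image (embed k) (Design.Adjacent k) u w
  edgePart-cover {inj₁ i}           {inj₁ j}           = image-++-complete (inj₁ i) (inj₁ j)
  edgePart-cover {inj₁ i}           {inj₂ (zero , y)}  = image-++-complete (inj₁ i) (inj₂ y)
  edgePart-cover {inj₁ i}           {inj₂ (suc g , y)} _ = image-++-bipartite (left-right {a = i} {b = y})
  edgePart-cover {inj₂ (zero , y)}  {inj₁ i}           = image-++-complete (inj₂ y) (inj₁ i)
  edgePart-cover {inj₂ (suc g , y)} {inj₁ i}           _ = image-++-bipartite (right-left {a = i} {b = y})
  edgePart-cover {inj₂ (g , y)}     {inj₂ (h , y′)}    = between-cover (pairOrDiagonal g h) refl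
    where
    between-cover : ∀ c → pairOrDiagonal g h ≡ c → point g y ≢ point h y′ →
      let k = [ bridge , diagonal ]′ c in Image (embed k) (Design.Adjacent k) (point g y) (point h y′)
    between-cover (inj₂ d) gh with pairOrDiagonal≡inj₂⇒ {i = g} {h} gh
    between-cover (inj₂ zero)    _ | refl , refl = image-++-complete {p = 3} (inj₂ y) (inj₂ y′)
    between-cover (inj₂ (suc d)) _ | refl , refl =
      λ u≢w → y , y′ , refl , refl , u≢w ∘ cong (point (suc d))
    between-cover (inj₁ p) gh with pairOrDiagonal≡inj₁⇒ {i = g} {h} gh
    ... | inj₁ (refl , refl) = λ _ → image-++-bipartite (left-right {a = y} {b = y′})
    ... | inj₂ (refl , refl) = λ _ → image-++-bipartite (right-left {a = y′} {b = y})

  diagonal-colour : ∀ d γ → diagonalOf γ ≡ diagonal d →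
                    (∀ k → colourPart (latin (d ⊕ d) k) γ ≡ diagonal d) →
                    ∀ c → colourPart (diagonalColours d c) γ ≡ diagonal d
  diagonal-colour d γ diagonal-γ latin-γ c = by-side (splitAt 8 c)
    where
    by-side : ∀ u → colourPart ([ latin (d ⊕ d) , spoke zero ++ global ]′ u) γ ≡ diagonal d
    by-side (inj₁ k) = latin-γ k
    by-side (inj₂ j) = trans (spoke-or-global (splitAt 4 j)) diagonal-γ
      where
      spoke-or-global : ∀ u → colourPart ([ spoke zero , global ]′ u) γ ≡ diagonalOf γ
      spoke-or-global (inj₁ _) = refl
      spoke-or-global (inj₂ _) = refl

  latin-diagonal : ∀ d k → colourPart (latin (d ⊕ d) k) (just d) ≡ diagonal d
  latin-diagonal d k = trans (cong (between d) (⊕-⊖-cancel d d)) (between-diagonal d)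

  colourPart-paint : ∀ k a c → colourPart (paint k c) (group (embed k a)) ≡ k
  colourPart-paint core a c = core-colour (splitAt 3 a)
    where
    core-colour : ∀ u → colourPart (diagonalColours zero c) (group ([ ∞ , point zero ]′ u)) ≡ core
    core-colour (inj₁ _) = diagonal-colour zero nothing refl (λ _ → refl) c
    core-colour (inj₂ _) = diagonal-colour zero (just zero) refl (latin-diagonal zero) c
  colourPart-paint (link g)   a c = refl
  colourPart-paint (clique g) a c = diagonal-colour (suc g) (just (suc g)) refl (latin-diagonal (suc g)) c
  colourPart-paint (bridge p) a c = bridge-colour (splitAt 12 a)
    where
    bridge-colour : ∀ u →
      colourPart (latin (lo p ⊕ hi p) c) (group ([ point (lo p) , point (hi p) ]′ u)) ≡ bridge p
    bridge-colour (inj₁ _) = trans (cong (between (lo p)) (⊕-⊖-cancel (lo p) (hi p))) (between-lo-hi p)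
    bridge-colour (inj₂ _) =
      trans (cong (λ s → between (hi p) (s ⊖ hi p)) (⊕-comm (lo p) (hi p)))
            (trans (cong (between (hi p)) (⊕-⊖-cancel (hi p) (lo p))) (between-hi-lo p))

  open Inverse vertices using (to; from; strictlyInverseˡ; strictlyInverseʳ)

  to-injective : Injective _≡_ _≡_ to
  to-injective {x} {y} eq = trans (sym (strictlyInverseʳ x)) (trans (cong from eq) (strictlyInverseʳ y))

  from-injective : Injective _≡_ _≡_ from
  from-injective {u} {w} eq = trans (sym (strictlyInverseˡ u)) (trans (cong to eq) (strictlyInverseˡ w))

  ι : ∀ k → Fin (Design.order k) → Fin (3 + t * 12)
  ι k = from ∘ embed k

  ι-injective : ∀ k → Injective _≡_ _≡_ (ι k)
  ι-injective k = embed-injective k ∘ from-injective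

  blocks : ∀ k → Design.Block k → Star (3 + t * 12)
  blocks k = mapStar (ι-injective k) ∘ Design.star k

  partOf : Fin (3 + t * 12) → Fin (3 + t * 12) → Part
  partOf x y = edgePart (group (to x)) (group (to y))

  decomposition : IsStarDecomposition _≢_ (uncurry blocks)
  decomposition = decomposition-⋃ partOf
    (λ k → decomposition-map (ι-injective k) (Design.decomposition k)) part-correct complete
    where
    part-correct : ∀ {k x y} → Image (ι k) (Design.Adjacent k) x y → partOf x y ≡ k
    part-correct {k} (a , b , refl , refl , ab) =
      edgePart-image k (a , b , sym (strictlyInverseˡ (embed k a)) , sym (strictlyInverseˡ (embed k b)) , ab)
    complete : ∀ {x y} → x ≢ y → Image (ι (partOf x y)) (Design.Adjacent (partOf x y)) x y
    complete {x} {y} x≢y with edgePart-cover (x≢y ∘ to-injective)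
    ... | a , b , ea≡ , eb≡ , ab =
      a , b , trans (cong from ea≡) (strictlyInverseʳ x) , trans (cong from eb≡) (strictlyInverseʳ y) , ab

  colouring : ∀ k → Design.Block k → Colour
  colouring k = paint k ∘ Design.colour k

  proper : IsProperColouring (uncurry blocks) (uncurry colouring)
  proper = proper-⋃ {B = blocks} {colour = colouring}
    (λ k → proper-recolour {B = blocks k} {colour = Design.colour k} (paint-injective k)
                      (proper-map {B = Design.star k} (ι-injective k) (Design.proper k)))
                    same-part
    where
    same-part : ∀ {k k′ i j v} → colouring k i ≡ colouring k′ j →
                VertexOf v (blocks k i) → VertexOf v (blocks k′ j) → k ≡ k′
    same-part {k} {k′} {i} {j} same v∈i v∈j
      with vertexOf-map⁻ (ι-injective k) (Design.star k i) v∈i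
         | vertexOf-map⁻ (ι-injective k′) (Design.star k′ j) v∈j
    ... | a , refl , _ | b , ιb≡ιa , _ = begin
      k                                                        ≡⟨ colourPart-paint k a _ ⟨
      colourPart (colouring k i) (group (embed k a))           ≡⟨ cong₂ colourPart same (cong group (sym (from-injective ιb≡ιa))) ⟩
      colourPart (colouring k′ j) (group (embed k′ b))         ≡⟨ colourPart-paint k′ b _ ⟩
      k′                                                       ∎
      where open ≡-Reasoning

  core-colour : ∀ c {c′} → paint core c ≡ c′ → ∃ λ β → uncurry colouring β ≡ c′
  core-colour c paint-c with K15-surjective c
  ... | β , colour-β = (core , β) , trans (cong (paint core) colour-β) paint-c

  surjective : ∀ c → ∃ λ β → uncurry colouring β ≡ c
  surjective (global e)     = core-colour (8 ↑ʳ (4 ↑ʳ e)) refl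
  surjective (spoke zero r) = core-colour (8 ↑ʳ (r ↑ˡ 2)) (lookup-++ˡ (spoke zero) global r)
  surjective (latin zero k) = core-colour (k ↑ˡ 6)
    (trans (lookup-++ˡ (latin (zero ⊕ zero)) _ k) (cong (λ s → latin s k) (⊕-identityˡ zero)))
  surjective (latin (suc s) k) with K12-12-surjective k
  ... | β , colour-β = (bridge (inj₂ s) , β) , cong₂ latin (⊕-identityˡ (suc s)) colour-β
  surjective (spoke (suc g) r) with K3-12-surjective r
  ... | β , colour-β = (link g , β) , cong (spoke (suc g)) colour-β

  finite : Finite (Σ Part Design.Block)
  finite = finite-Σ parts Design.finite
    where parts = finite-⊎ (1 , 1↔⊤) (finite-⊎ finite-Fin (finite-⊎ finite-Fin (finite-Pair t)))

  blockColourableSystem : Σ ℕ λ m → Σ (Fin m → Star (3 + t * 12)) λ B →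
    IsStarSystem (3 + t * 12) m B × BlockColourable B ((3 + t * 12) ∸ 1)
  blockColourableSystem = blockColourableStarSystem finite colours decomposition proper surjective

twelve-plus-three : ∀ n → 15 ≤ n → n % 12 ≡ 3 → ∃ λ t′ → n ≡ 3 + suc t′ * 12
twelve-plus-three n 15≤n n%12≡3 =
  from-quotient (n / 12) (trans (m≡m%n+[m/n]*n n 12) (cong (_+ n / 12 * 12) n%12≡3))
  where
  from-quotient : ∀ q → n ≡ 3 + q * 12 → ∃ λ t′ → n ≡ 3 + suc t′ * 12
  from-quotient zero    n≡3 = contradiction (subst (15 ≤_) n≡3 15≤n) (from-no (15 ≤? 3))
  from-quotient (suc t′) eq = t′ , eq

theorem4p1 : (n : ℕ) → 15 ≤ n → n % 12 ≡ 3 →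
    Σ ℕ (λ m → Σ (Fin m → Star n) (λ B →
    IsStarSystem n m B × BlockColourable B (n ∸ 1)))
theorem4p1 n 15≤n n%12≡3 with twelve-plus-three n 15≤n n%12≡3
... | t′ , refl = Construction.blockColourableSystem t′
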